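{- Let $T\in[0\mathinner{.\,.}\sigma)^n$ with $\sigma\ge3$, and let $k=\lceil\log\sigma\rceil$. For $a\in[0\mathinner{.\,.}\sigma)$ let $C(a)=\mathrm{pad}_k(\mathrm{bin}_k(a))$, let $B=1^{2k-1}0$, and let $T'=B\cdot C(T[1])\cdot B\cdot C(T[2])\cdots B\cdot C(T[n])$. Let $\delta=4k$. Then for every $i\in[1\mathinner{.\,.}n]$, $\mathrm{LPF}_T[i]=\left\lfloor \mathrm{LPF}_{T'}[(i-1)\delta+1]/\delta\right\rfloor$ and $\mathrm{LPnF}_T[i]=\left\lfloor \mathrm{LPnF}_{T'}[(i-1)\delta+1]/\delta\right\rfloor$.
   Context: For $x\in[0\mathinner{.\,.}2^k)$, $\mathrm{bin}_k(x)\in\{0,1\}^k$ is the binary representation of $x$ with leading zeros. For $X\in\{0,1\}^k$, $\mathrm{pad}_k(X)\in\{0,1\}^{2k}$ is the string $Y$ with $Y[2i-1]=X[i]$ and $Y[2i]=0$. For a string $X$ of length $N$ and $i\in[1\mathinner{.\,.}N]$, $\mathrm{LPF}_X[i]$ is the largest $\ell\ge0$ such that $X[j\mathinner{.\,.}j+\ell)=X[i\mathinner{.\,.}i+\ell)$ for some $j<i$; $\mathrm{LPnF}_X[i]$ is defined the same way with the extra requirement $j+\ell\le i$. -}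

module Defs where

open import Data.Nat using (ℕ; zero; suc; _+_; _*_; _∸_; _≤_; _<_)
open import Data.Nat.DivMod using (_/_; _%_)
open import Data.Nat.Logarithm using (⌈log₂_⌉)
open import Data.List using (List; []; _∷_; _++_; length; replicate; concatMap)
open import Data.Maybe using (Maybe; just; nothing)
open import Data.Product using (Σ; _×_; ∃)
open import Data.Sum using (_⊎_)
open import Relation.Binary.PropositionalEquality using (_≡_)

-- Strings are lists; positions are 1-based: X at p = just X[p] for p ∈ [1..|X|],
-- nothing otherwise.
_at_ : {A : Set} → List A → ℕ → Maybe A
[] at _ = nothing
(x ∷ xs) at zero = nothing
(x ∷ xs) at suc zero = just x
(x ∷ xs) at suc (suc p) = xs at suc p

FragEq : {A : Set} → List A → ℕ → ℕ → ℕ → Set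
FragEq X j i ℓ =
  (j + ℓ ≤ suc (length X)) × (i + ℓ ≤ suc (length X)) ×
  ((t : ℕ) → t < ℓ → X at (j + t) ≡ X at (i + t))

-- ℓ is admissible for LPF_X[i]: some j ∈ [1..i) with X[j..j+ℓ) = X[i..i+ℓ).
-- ℓ = 0 is always admissible (this only matters for i = 1, where no j exists;
-- the convention there is LPF_X[1] = 0).
CandLPF : {A : Set} → List A → ℕ → ℕ → Set
CandLPF X i ℓ = (ℓ ≡ 0) ⊎ (∃ λ j → (1 ≤ j) × (j < i) × FragEq X j i ℓ)

CandLPnF : {A : Set} → List A → ℕ → ℕ → Set
CandLPnF X i ℓ = (ℓ ≡ 0) ⊎ (∃ λ j → (1 ≤ j) × (j < i) × (j + ℓ ≤ i) × FragEq X j i ℓ)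

IsLPF : {A : Set} → List A → ℕ → ℕ → Set
IsLPF X i ℓ = CandLPF X i ℓ × ((m : ℕ) → CandLPF X i m → m ≤ ℓ)

IsLPnF : {A : Set} → List A → ℕ → ℕ → Set
IsLPnF X i ℓ = CandLPnF X i ℓ × ((m : ℕ) → CandLPnF X i m → m ≤ ℓ)

bin : ℕ → ℕ → List ℕ
bin zero x = []
bin (suc k) x = bin k (x / 2) ++ (x % 2 ∷ [])

pad : List ℕ → List ℕ
pad = concatMap (λ b → b ∷ 0 ∷ [])

kOf : ℕ → ℕ
kOf σ = ⌈log₂ σ ⌉

codeC : ℕ → ℕ → List ℕ
codeC k a = pad (bin k a)

blockB : ℕ → List ℕ
blockB k = replicate (2 * k ∸ 1) 1 ++ (0 ∷ [])

encode : ℕ → List ℕ → List ℕ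
encode σ T = concatMap (λ a → blockB (kOf σ) ++ codeC (kOf σ) a) T

-- floor division; d = 0 never occurs in the theorem (δ = 4k ≥ 8)
divℕ : ℕ → ℕ → ℕ
divℕ m zero = 0
divℕ m (suc d) = m / suc d

{-# OPTIONS --safe #-}
-- Each symbol a < σ ≤ 2^k is encoded by the block B·C(a) of length δ = 4k, and distinct
-- symbols get distinct blocks. The blocks are cross-bifix-free: every block starts with
-- 2k − 1 ones, while from any offset inside a block a 0 (the last symbol of B or a padding
-- 0) follows within 2k − 2 steps; this is where σ ≥ 3, i.e. k ≥ 2, is needed. Hence an
-- earlier occurrence in T′ of a prefix of T′[(i−1)δ+1 ..] of length ℓ ≥ δ starts at a block
-- boundary and decodes to an earlier occurrence in T of length ⌊ℓ/δ⌋, while an occurrence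
-- of length m in T encodes to one of length mδ in T′. Both translations preserve
-- non-overlap, so the same argument gives LPnF.
module Submission where

open import Defs
open import Data.Nat
  using (ℕ; zero; suc; _+_; _*_; _∸_; _^_; _≤_; _<_; z≤n; s≤s; z<s; ⌈_/2⌉; NonZero; >-nonZero; _≟_; _≤?_)
open import Data.Nat.Properties
open import Data.Nat.DivMod
open import Data.Nat.Divisibility using (n∣m*n)
open import Data.Nat.Logarithm using (⌈log₂_⌉; ⌈log₂⌉-mono-≤)
open import Data.Nat.Logarithm.Core using (⌈log2⌉)
open import Data.Nat.Tactic.RingSolver using (solve-∀)
open import Induction.WellFounded using (Acc; acc)
open import Data.List using (List; []; _∷_; _++_; length; replicate; concatMap)
open import Data.List.Properties
  using (length-++; length-replicate; ++-assoc; ++-cancelˡ; ∷ʳ-injective; ∷-injective; ∷-injectiveʳ)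
open import Data.List.Relation.Unary.All as All using (All; []; _∷_)
open import Data.Maybe using (just; nothing; _>>=_)
open import Data.Maybe.Properties using (just-injective; ≡-dec)
open import Data.Product using (Σ; _×_; ∃; _,_)
open import Data.Sum using (_⊎_; inj₁; inj₂)
open import Relation.Nullary using (Dec; yes; no; contradiction)
open import Relation.Nullary.Decidable using (map′; _×-dec_; _⊎-dec_)
open import Relation.Unary using (Decidable)
open import Relation.Binary.Definitions using (DecidableEquality)
open import Relation.Binary.PropositionalEquality

module _ {A : Set} where

  at-zero : (xs : List A) → xs at 0 ≡ nothing
  at-zero []      = refl
  at-zero (_ ∷ _) = refl

  at-++ˡ : ∀ (xs ys : List A) {p} → p ≤ length xs → (xs ++ ys) at p ≡ xs at p
  at-++ˡ []       ys z≤n = at-zero ys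
  at-++ˡ (x ∷ xs) ys {zero}        _         = refl
  at-++ˡ (x ∷ xs) ys {suc zero}    _         = refl
  at-++ˡ (x ∷ xs) ys {suc (suc p)} (s≤s p≤) = at-++ˡ xs ys p≤

  at-++ʳ : ∀ (xs ys : List A) p → (xs ++ ys) at suc (length xs + p) ≡ ys at suc p
  at-++ʳ []       ys p = refl
  at-++ʳ (x ∷ xs) ys p = at-++ʳ xs ys p

  at-replicate : ∀ n (x : A) {t} → t < n → replicate n x at suc t ≡ just x
  at-replicate (suc n) x {zero}  _         = refl
  at-replicate (suc n) x {suc t} (s≤s t<n) = at-replicate n x t<n

  All-at : ∀ {P : A → Set} {xs} → All P xs → ∀ {p} → p < length xs →
            ∃ λ a → xs at suc p ≡ just a × P a
  All-at (pa ∷ _)  {zero}  _         = _ , refl , pa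
  All-at (_  ∷ ps) {suc p} (s≤s p<n) = All-at ps p<n

  at-defined : ∀ (xs : List A) {p} → p < length xs → ∃ λ x → xs at suc p ≡ just x
  at-defined (x ∷ xs) {zero}  _         = x , refl
  at-defined (x ∷ xs) {suc p} (s≤s p<n) = at-defined xs p<n

  at-ext : ∀ (xs ys : List A) → length xs ≡ length ys →
           (∀ {p} → p < length xs → xs at suc p ≡ ys at suc p) → xs ≡ ys
  at-ext []       []       _  _  = refl
  at-ext (x ∷ xs) (y ∷ ys) eq at≡ =
    cong₂ _∷_ (just-injective (at≡ z<s)) (at-ext xs ys (suc-injective eq) (λ p< → at≡ (s≤s p<)))

fragEq-length : ∀ {A : Set} (X : List A) {j i ℓ} → 1 ≤ j → FragEq X j i ℓ → ℓ ≤ length X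
fragEq-length X {ℓ = ℓ} 1≤j (j+ℓ≤ , _) = ≤-pred (≤-trans (+-monoˡ-≤ ℓ 1≤j) j+ℓ≤)

bounded⇒∃-maximum : ∀ {P : ℕ → Set} → Decidable P → P 0 → ∀ n → (∀ {m} → P m → m ≤ n) →
                    ∃ λ ℓ → P ℓ × (∀ m → P m → m ≤ ℓ)
bounded⇒∃-maximum {P} P? P0 n bounded =
  let ℓ , Pℓ , maximal = search n in ℓ , Pℓ , λ m Pm → maximal (bounded Pm) Pm
  where
  search : ∀ n → ∃ λ ℓ → P ℓ × (∀ {m} → m ≤ n → P m → m ≤ ℓ)
  search zero = 0 , P0 , λ m≤0 _ → m≤0
  search (suc n) with P? (suc n) | search n
  ... | yes Pn | _ = suc n , Pn , λ m≤n _ → m≤n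
  ... | no ¬Pn | ℓ , Pℓ , max = ℓ , Pℓ , max′
    where
    max′ : ∀ {m} → m ≤ suc n → P m → m ≤ ℓ
    max′ {m} m≤ Pm with m ≟ suc n
    ... | yes refl = contradiction Pm ¬Pn
    ... | no  m≢   = max (≤-pred (≤∧≢⇒< m≤ m≢)) Pm

module _ {A : Set} (_≟ᴬ_ : DecidableEquality A) where

  fragEq? : ∀ (X : List A) j i ℓ → Dec (FragEq X j i ℓ)
  fragEq? X j i ℓ =
    (j + ℓ ≤? suc (length X)) ×-dec (i + ℓ ≤? suc (length X)) ×-dec
    map′ (λ agree t t<ℓ → agree t<ℓ) (λ agree {t} t<ℓ → agree t t<ℓ)
         (allUpTo? (λ t → ≡-dec _≟ᴬ_ (X at (j + t)) (X at (i + t))) ℓ)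

  candLPF? : ∀ (X : List A) i → Decidable (CandLPF X i)
  candLPF? X i ℓ = (ℓ ≟ 0) ⊎-dec
    map′ (λ (j , j<i , 1≤j , F) → j , 1≤j , j<i , F) (λ (j , 1≤j , j<i , F) → j , j<i , 1≤j , F)
         (anyUpTo? (λ j → (1 ≤? j) ×-dec fragEq? X j i ℓ) i)

  candLPnF? : ∀ (X : List A) i → Decidable (CandLPnF X i)
  candLPnF? X i ℓ = (ℓ ≟ 0) ⊎-dec
    map′ (λ (j , j<i , 1≤j , j+ℓ≤i , F) → j , 1≤j , j<i , j+ℓ≤i , F)
         (λ (j , 1≤j , j<i , j+ℓ≤i , F) → j , j<i , 1≤j , j+ℓ≤i , F)
         (anyUpTo? (λ j → (1 ≤? j) ×-dec (j + ℓ ≤? i) ×-dec fragEq? X j i ℓ) i)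

  lpf-exists : ∀ (X : List A) i → ∃ (IsLPF X i)
  lpf-exists X i = bounded⇒∃-maximum (candLPF? X i) (inj₁ refl) (length X) bounded
    where
    bounded : ∀ {m} → CandLPF X i m → m ≤ length X
    bounded (inj₁ refl)                = z≤n
    bounded (inj₂ (j , 1≤j , _ , F)) = fragEq-length X 1≤j F

  lpnf-exists : ∀ (X : List A) i → ∃ (IsLPnF X i)
  lpnf-exists X i = bounded⇒∃-maximum (candLPnF? X i) (inj₁ refl) (length X) bounded
    where
    bounded : ∀ {m} → CandLPnF X i m → m ≤ length X
    bounded (inj₁ refl)                    = z≤n
    bounded (inj₂ (j , 1≤j , _ , _ , F)) = fragEq-length X 1≤j F

length-concatMap : ∀ {A B : Set} (f : A → List B) {δ} → (∀ a → length (f a) ≡ δ) →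
                   ∀ T → length (concatMap f T) ≡ length T * δ
length-concatMap f length-f []      = refl
length-concatMap f length-f (a ∷ T) =
  trans (length-++ (f a)) (cong₂ _+_ (length-f a) (length-concatMap f length-f T))

-- No nonempty proper suffix of a codeword of length δ is a prefix of a codeword;
-- t is a mismatch position inside the overlap.
CrossBifixFree : ∀ {A B : Set} → (A → List B) → ℕ → Set
CrossBifixFree f δ = ∀ a b o → 1 ≤ o → o < δ →
  ∃ λ t → o + t < δ × f a at suc (o + t) ≢ f b at suc t

shifted-offset : ∀ b o t d → b * d + suc o + t ≡ b * d + suc (o + t)
shifted-offset = solve-∀

aligned-offset : ∀ j q r d → j * d + 1 + (q * d + r) ≡ (j + q) * d + suc r
aligned-offset = solve-∀

aligned-end : ∀ j m d → j * d + 1 + m * d ≡ (j + m) * d + 1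
aligned-end = solve-∀

module BlockCode {A B : Set} (f : A → List B) (δ : ℕ) .{{_ : NonZero δ}}
                 (length-f : ∀ a → length (f a) ≡ δ) where

  suc-length-concatMap : ∀ T → suc (length (concatMap f T)) ≡ length T * δ + 1
  suc-length-concatMap T = trans (cong suc (length-concatMap f length-f T)) (+-comm 1 _)

  concatMap-at : ∀ T b {o} → o < δ →
                 concatMap f T at (b * δ + suc o) ≡ (T at suc b >>= λ a → f a at suc o)
  concatMap-at []      b       o<δ = refl
  concatMap-at (a ∷ T) zero    o<δ = at-++ˡ (f a) _ (subst (_ ≤_) (sym (length-f a)) o<δ)
  concatMap-at (a ∷ T) (suc b) {o} o<δ = begin
    concatMap f (a ∷ T) at (suc b * δ + suc o)       ≡⟨ cong (concatMap f (a ∷ T) at_) position ⟩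
    (f a ++ concatMap f T) at suc (length (f a) + (b * δ + o))
                                                     ≡⟨ at-++ʳ (f a) _ _ ⟩
    concatMap f T at suc (b * δ + o)                 ≡⟨ cong (concatMap f T at_) (+-suc (b * δ) o) ⟨
    concatMap f T at (b * δ + suc o)                 ≡⟨ concatMap-at T b o<δ ⟩
    (T at suc b >>= λ a → f a at suc o)             ∎
    where
    open ≡-Reasoning
    position : suc b * δ + suc o ≡ suc (length (f a) + (b * δ + o))
    position = trans (+-assoc δ (b * δ) (suc o))
                     (trans (cong₂ _+_ (sym (length-f a)) (+-suc (b * δ) o)) (+-suc (length (f a)) (b * δ + o)))

  concatMap-at-shifted : ∀ T b {o t} → o + t < δ →
    concatMap f T at (b * δ + suc o + t) ≡ (T at suc b >>= λ a → f a at suc (o + t))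
  concatMap-at-shifted T b {o} {t} o+t<δ =
    trans (cong (concatMap f T at_) (shifted-offset b o t δ)) (concatMap-at T b o+t<δ)

  concatMap-at-block : ∀ T j q {r} → r < δ →
    concatMap f T at (j * δ + 1 + (q * δ + r)) ≡ (T at suc (j + q) >>= λ a → f a at suc r)
  concatMap-at-block T j q {r} r<δ =
    trans (cong (concatMap f T at_) (aligned-offset j q r δ)) (concatMap-at T (j + q) r<δ)

  concatMap-at-aligned : ∀ T j t →
    concatMap f T at (j * δ + 1 + t) ≡ (T at suc (j + t / δ) >>= λ a → f a at suc (t % δ))
  concatMap-at-aligned T j t =
    trans (cong (λ t → concatMap f T at (j * δ + 1 + t)) (trans (m≡m%n+[m/n]*n t δ) (+-comm (t % δ) _)))
          (concatMap-at-block T j (t / δ) (m%n<n t δ))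

  *δ≤⇒≤/δ : ∀ {m ℓ} → m * δ ≤ ℓ → m ≤ ℓ / δ
  *δ≤⇒≤/δ {m} mδ≤ℓ = subst (_≤ _) (m*n/n≡m m δ) (/-monoˡ-≤ δ mδ≤ℓ)

  <-/δ⇒*δ+< : ∀ {q ℓ r} → q < ℓ / δ → r < δ → q * δ + r < ℓ
  <-/δ⇒*δ+< {q} {ℓ} {r} q<ℓ/δ r<δ = begin-strict
    q * δ + r  <⟨ +-monoʳ-< (q * δ) r<δ ⟩
    q * δ + δ  ≡⟨ +-comm (q * δ) δ ⟩
    suc q * δ  ≤⟨ *-monoˡ-≤ δ q<ℓ/δ ⟩
    ℓ / δ * δ  ≤⟨ m/n*n≤m ℓ δ ⟩
    ℓ          ∎
    where open ≤-Reasoning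

  *δ+≤⇒+/δ≤ : ∀ {x ℓ n} → x * δ + ℓ ≤ n * δ → x + ℓ / δ ≤ n
  *δ+≤⇒+/δ≤ {x} {ℓ} {n} le = begin
    x + ℓ / δ            ≡⟨ cong (_+ ℓ / δ) (m*n/n≡m x δ) ⟨
    x * δ / δ + ℓ / δ    ≡⟨ +-distrib-/-∣ˡ ℓ (n∣m*n x) ⟨
    (x * δ + ℓ) / δ      ≤⟨ /-monoˡ-≤ δ le ⟩
    n * δ / δ            ≡⟨ m*n/n≡m n δ ⟩
    n                    ∎
    where open ≤-Reasoning

  aligned-<⁺ : ∀ {j i} → j < i → j * δ + 1 < i * δ + 1
  aligned-<⁺ j<i = +-monoˡ-< 1 (*-monoˡ-< δ j<i)

  aligned-<⁻ : ∀ {j i} → j * δ + 1 < i * δ + 1 → j < i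
  aligned-<⁻ {j} {i} lt = *-cancelʳ-< δ j i (+-cancelʳ-< 1 _ _ lt)

  aligned-end-≤⁺ : ∀ {j m n} → suc j + m ≤ suc n → j * δ + 1 + m * δ ≤ n * δ + 1
  aligned-end-≤⁺ {j} {m} {n} le =
    subst (_≤ n * δ + 1) (sym (aligned-end j m δ)) (+-monoˡ-≤ 1 (*-monoˡ-≤ δ (≤-pred le)))

  aligned-end-≤⁻ : ∀ {j ℓ n} → j * δ + 1 + ℓ ≤ n * δ + 1 → suc j + ℓ / δ ≤ suc n
  aligned-end-≤⁻ {j} {ℓ} {n} le =
    s≤s (*δ+≤⇒+/δ≤ (+-cancelʳ-≤ 1 _ _ (subst (_≤ n * δ + 1) (swap-1 (j * δ) ℓ) le)))
    where
    swap-1 : ∀ x ℓ → x + 1 + ℓ ≡ x + ℓ + 1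
    swap-1 = solve-∀

  FragEq-concatMap⁺ : ∀ {T j i m} → FragEq T (suc j) (suc i) m →
                      FragEq (concatMap f T) (j * δ + 1) (i * δ + 1) (m * δ)
  FragEq-concatMap⁺ {T} {j} {i} {m} (j-end , i-end , agree) = end j-end , end i-end , agree′
    where
    end : ∀ {x} → suc x + m ≤ suc (length T) → x * δ + 1 + m * δ ≤ suc (length (concatMap f T))
    end {x} x-end = subst (x * δ + 1 + m * δ ≤_) (sym (suc-length-concatMap T)) (aligned-end-≤⁺ {x} x-end)
    agree′ : ∀ t → t < m * δ → concatMap f T at (j * δ + 1 + t) ≡ concatMap f T at (i * δ + 1 + t)
    agree′ t t<mδ = begin
      concatMap f T at (j * δ + 1 + t)                      ≡⟨ concatMap-at-aligned T j t ⟩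
      (T at suc (j + t / δ) >>= λ a → f a at suc (t % δ)) ≡⟨ cong (_>>= _) (agree (t / δ) (m<n*o⇒m/o<n t<mδ)) ⟩
      (T at suc (i + t / δ) >>= λ a → f a at suc (t % δ)) ≡⟨ concatMap-at-aligned T i t ⟨
      concatMap f T at (i * δ + 1 + t)                      ∎
      where open ≡-Reasoning

  FragEq-concatMap⁻ : ∀ {P : A → Set} → (∀ {a b} → P a → P b → f a ≡ f b → a ≡ b) →
                      ∀ {T j i ℓ} → All P T → FragEq (concatMap f T) (j * δ + 1) (i * δ + 1) ℓ →
                      FragEq T (suc j) (suc i) (ℓ / δ)
  FragEq-concatMap⁻ f-injective {T} {j} {i} {ℓ} PT (j-end , i-end , agree) =
    end j-end , end i-end , agree′
    where
    end : ∀ {x} → x * δ + 1 + ℓ ≤ suc (length (concatMap f T)) → suc x + ℓ / δ ≤ suc (length T)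
    end {x} x-end = aligned-end-≤⁻ (subst (x * δ + 1 + ℓ ≤_) (suc-length-concatMap T) x-end)
    agree′ : ∀ q → q < ℓ / δ → T at (suc j + q) ≡ T at (suc i + q)
    agree′ q q<ℓ/δ with All-at PT (≤-pred (≤-trans (+-monoʳ-< (suc j) q<ℓ/δ) (end j-end)))
                      | All-at PT (≤-pred (≤-trans (+-monoʳ-< (suc i) q<ℓ/δ) (end i-end)))
    ... | a , T[j+q]≡a , Pa | b , T[i+q]≡b , Pb =
      trans T[j+q]≡a (trans (cong just (f-injective Pa Pb fa≡fb)) (sym T[i+q]≡b))
      where
      codeword : ∀ {x c r} → T at suc (x + q) ≡ just c → r < δ →
                 concatMap f T at (x * δ + 1 + (q * δ + r)) ≡ f c at suc r
      codeword {x} T[x+q]≡c r<δ = trans (concatMap-at-block T x q r<δ) (cong (_>>= _) T[x+q]≡c)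
      fa≡fb : f a ≡ f b
      fa≡fb = at-ext (f a) (f b) (trans (length-f a) (sym (length-f b)))
                     (λ r< → same-symbol (subst (_ <_) (length-f a) r<))
        where
        same-symbol : ∀ {r} → r < δ → f a at suc r ≡ f b at suc r
        same-symbol {r} r<δ = trans (sym (codeword T[j+q]≡a r<δ))
          (trans (agree (q * δ + r) (<-/δ⇒*δ+< q<ℓ/δ r<δ)) (codeword T[i+q]≡b r<δ))

  FragEq-concatMap-shifted : CrossBifixFree f δ → ∀ {T b o i ℓ} → i < length T →
    1 ≤ o → o < δ → FragEq (concatMap f T) (b * δ + suc o) (i * δ + 1) ℓ → ℓ < δ
  FragEq-concatMap-shifted cbf {T} {b} {o} {i} {ℓ} i<n 1≤o o<δ (_ , _ , agree)
    with at-defined T i<n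
  ... | c , T[i]≡c = short (T at suc b) refl
    where
    agree-at : ∀ {t} → o + t < δ → t < ℓ → (T at suc b >>= λ a → f a at suc (o + t)) ≡ f c at suc t
    agree-at {t} o+t<δ t<ℓ = begin
      (T at suc b >>= λ a → f a at suc (o + t)) ≡⟨ concatMap-at-shifted T b o+t<δ ⟨
      concatMap f T at (b * δ + suc o + t)       ≡⟨ agree t t<ℓ ⟩
      concatMap f T at (i * δ + 1 + t)           ≡⟨ concatMap-at-shifted T i (≤-<-trans (m≤n+m t o) o+t<δ) ⟩
      (T at suc i >>= λ a → f a at suc t)       ≡⟨ cong (_>>= _) T[i]≡c ⟩
      f c at suc t                               ∎
      where open ≡-Reasoning
    0<δ : 0 < δ
    0<δ = ≤-<-trans z≤n o<δ
    short : ∀ x → T at suc b ≡ x → ℓ < δ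
    short nothing T[b]≡nothing with at-defined (f c) (subst (0 <_) (sym (length-f c)) 0<δ)
    ... | y , f[c]₀≡y = ≤-<-trans (≮⇒≥ λ 0<ℓ → nothing≢just (begin
      nothing                                    ≡⟨ cong (_>>= _) T[b]≡nothing ⟨
      (T at suc b >>= λ a → f a at suc (o + 0)) ≡⟨ agree-at (subst (_< δ) (sym (+-identityʳ o)) o<δ) 0<ℓ ⟩
      f c at 1                                   ≡⟨ f[c]₀≡y ⟩
      just y                                     ∎)) 0<δ
      where
      open ≡-Reasoning
      nothing≢just : nothing ≢ just y
      nothing≢just ()
    short (just a) T[b]≡a with cbf a c o 1≤o o<δ
    ... | t , o+t<δ , mismatch =
      ≤-<-trans (≮⇒≥ λ t<ℓ → mismatch (trans (cong (_>>= _) (sym T[b]≡a)) (agree-at o+t<δ t<ℓ)))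
                (≤-<-trans (m≤n+m t o) o+t<δ)

  aligned-or-short : CrossBifixFree f δ → ∀ {T i j′ ℓ} → i < length T → 1 ≤ j′ →
    FragEq (concatMap f T) j′ (i * δ + 1) ℓ → ℓ < δ ⊎ ∃ λ j → j′ ≡ j * δ + 1
  aligned-or-short cbf {T} {i} {suc p} {ℓ} i<n _ F = split (p % δ) refl (m%n<n p δ)
    where
    position : ∀ {o} → p % δ ≡ o → suc p ≡ p / δ * δ + suc o
    position {o} p%δ≡o = begin
      suc p                      ≡⟨ cong suc (m≡m%n+[m/n]*n p δ) ⟩
      suc (p % δ + p / δ * δ)    ≡⟨ cong suc (+-comm (p % δ) _) ⟩
      suc (p / δ * δ + p % δ)    ≡⟨ +-suc _ (p % δ) ⟨
      p / δ * δ + suc (p % δ)    ≡⟨ cong (λ o → p / δ * δ + suc o) p%δ≡o ⟩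
      p / δ * δ + suc o          ∎
      where open ≡-Reasoning
    split : ∀ o → p % δ ≡ o → o < δ → ℓ < δ ⊎ ∃ λ j → suc p ≡ j * δ + 1
    split zero    p%δ≡0 _   = inj₂ (p / δ , position p%δ≡0)
    split (suc o) p%δ≡o o<δ = inj₁ (FragEq-concatMap-shifted cbf {T} {p / δ} {suc o} {i} {ℓ} i<n (s≤s z≤n) o<δ
      (subst (λ j′ → FragEq (concatMap f T) j′ (i * δ + 1) ℓ) (position p%δ≡o) F))

  CandLPF-concatMap⁺ : ∀ {T i m} → CandLPF T (suc i) m → CandLPF (concatMap f T) (i * δ + 1) (m * δ)
  CandLPF-concatMap⁺ (inj₁ refl)                       = inj₁ refl
  CandLPF-concatMap⁺ {T} {i} {m} (inj₂ (suc j , _ , s≤s j<i , F)) =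
    inj₂ (j * δ + 1 , m≤n+m 1 _ , aligned-<⁺ j<i , FragEq-concatMap⁺ {T} {j} {i} {m} F)

  CandLPnF-concatMap⁺ : ∀ {T i m} → CandLPnF T (suc i) m → CandLPnF (concatMap f T) (i * δ + 1) (m * δ)
  CandLPnF-concatMap⁺ (inj₁ refl)                              = inj₁ refl
  CandLPnF-concatMap⁺ {T} {i} {m} (inj₂ (suc j , _ , s≤s j<i , end≤ , F)) =
    inj₂ (j * δ + 1 , m≤n+m 1 _ , aligned-<⁺ j<i , aligned-end-≤⁺ {j} end≤ ,
          FragEq-concatMap⁺ {T} {j} {i} {m} F)

  module _ {P : A → Set} (f-injective : ∀ {a b} → P a → P b → f a ≡ f b → a ≡ b)
           (cbf : CrossBifixFree f δ) {T} (PT : All P T) {i} (i<n : i < length T) where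

    CandLPF-concatMap⁻ : ∀ {ℓ} → CandLPF (concatMap f T) (i * δ + 1) ℓ → CandLPF T (suc i) (ℓ / δ)
    CandLPF-concatMap⁻ (inj₁ refl) = inj₁ (0/n≡0 δ)
    CandLPF-concatMap⁻ {ℓ} (inj₂ (j′ , 1≤j′ , j′<i′ , F))
      with aligned-or-short cbf {T} {i} {j′} {ℓ} i<n 1≤j′ F
    ... | inj₁ ℓ<δ        = inj₁ (m<n⇒m/n≡0 ℓ<δ)
    ... | inj₂ (j , refl) =
      inj₂ (suc j , s≤s z≤n , s≤s (aligned-<⁻ j′<i′) , FragEq-concatMap⁻ f-injective PT F)

    CandLPnF-concatMap⁻ : ∀ {ℓ} → CandLPnF (concatMap f T) (i * δ + 1) ℓ → CandLPnF T (suc i) (ℓ / δ)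
    CandLPnF-concatMap⁻ (inj₁ refl) = inj₁ (0/n≡0 δ)
    CandLPnF-concatMap⁻ {ℓ} (inj₂ (j′ , 1≤j′ , j′<i′ , end≤ , F))
      with aligned-or-short cbf {T} {i} {j′} {ℓ} i<n 1≤j′ F
    ... | inj₁ ℓ<δ        = inj₁ (m<n⇒m/n≡0 ℓ<δ)
    ... | inj₂ (j , refl) =
      inj₂ (suc j , s≤s z≤n , s≤s (aligned-<⁻ j′<i′) , aligned-end-≤⁻ end≤ , FragEq-concatMap⁻ f-injective PT F)

    IsLPF-concatMap⁻ : ∀ {ℓ} → IsLPF (concatMap f T) (i * δ + 1) ℓ → IsLPF T (suc i) (ℓ / δ)
    IsLPF-concatMap⁻ (cand , maximal) =
      CandLPF-concatMap⁻ cand , λ m cand-m → *δ≤⇒≤/δ (maximal (m * δ) (CandLPF-concatMap⁺ {T} {i} {m} cand-m))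

    IsLPnF-concatMap⁻ : ∀ {ℓ} → IsLPnF (concatMap f T) (i * δ + 1) ℓ → IsLPnF T (suc i) (ℓ / δ)
    IsLPnF-concatMap⁻ (cand , maximal) =
      CandLPnF-concatMap⁻ cand , λ m cand-m → *δ≤⇒≤/δ (maximal (m * δ) (CandLPnF-concatMap⁺ {T} {i} {m} cand-m))

n≤2^⌈log2⌉n : ∀ n (rec : Acc _<_ n) → n ≤ 2 ^ ⌈log2⌉ n rec
n≤2^⌈log2⌉n zero          _        = z≤n
n≤2^⌈log2⌉n (suc zero)    _        = s≤s z≤n
n≤2^⌈log2⌉n (suc (suc n)) (acc rs) = begin
  2 + n                         ≤⟨ +-monoʳ-≤ 2 n≤2⌈n/2⌉ ⟩
  2 + (⌈ n /2⌉ + ⌈ n /2⌉)       ≡⟨ cong suc (+-suc ⌈ n /2⌉ ⌈ n /2⌉) ⟨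
  suc ⌈ n /2⌉ + suc ⌈ n /2⌉     ≤⟨ +-mono-≤ half≤ half≤ ⟩
  2 ^ L + 2 ^ L                 ≡⟨ cong (2 ^ L +_) (+-identityʳ (2 ^ L)) ⟨
  2 ^ suc L                     ∎
  where
  open ≤-Reasoning
  L : ℕ
  L = ⌈log2⌉ (suc ⌈ n /2⌉) _
  half≤ : suc ⌈ n /2⌉ ≤ 2 ^ L
  half≤ = n≤2^⌈log2⌉n (suc ⌈ n /2⌉) _
  n≤2⌈n/2⌉ : n ≤ ⌈ n /2⌉ + ⌈ n /2⌉
  n≤2⌈n/2⌉ = subst (_≤ ⌈ n /2⌉ + ⌈ n /2⌉) (⌊n/2⌋+⌈n/2⌉≡n n) (+-monoˡ-≤ ⌈ n /2⌉ (⌊n/2⌋≤⌈n/2⌉ n))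

n≤2^⌈log₂n⌉ : ∀ n → n ≤ 2 ^ ⌈log₂ n ⌉
n≤2^⌈log₂n⌉ n = n≤2^⌈log2⌉n n _

length-bin : ∀ k x → length (bin k x) ≡ k
length-bin zero    x = refl
length-bin (suc k) x = trans (length-++ (bin k (x / 2))) (trans (+-comm _ 1) (cong suc (length-bin k (x / 2))))

bin-injective : ∀ k {x y} → x < 2 ^ k → y < 2 ^ k → bin k x ≡ bin k y → x ≡ y
bin-injective zero    {zero} {zero} _ _ _ = refl
bin-injective zero    {suc x} (s≤s ()) _
bin-injective zero    {y = suc y} _ (s≤s ())
bin-injective (suc k) {x} {y} x< y< bx≡by with ∷ʳ-injective (bin k (x / 2)) (bin k (y / 2)) bx≡by
... | halves≡ , x%2≡y%2 = begin
  x                    ≡⟨ m≡m%n+[m/n]*n x 2 ⟩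
  x % 2 + x / 2 * 2    ≡⟨ cong₂ (λ r q → r + q * 2) x%2≡y%2 (bin-injective k (half< x<) (half< y<) halves≡) ⟩
  y % 2 + y / 2 * 2    ≡⟨ m≡m%n+[m/n]*n y 2 ⟨
  y                    ∎
  where
  open ≡-Reasoning
  half< : ∀ {z} → z < 2 ^ suc k → z / 2 < 2 ^ k
  half< {z} z< = m<n*o⇒m/o<n (subst (z <_) (*-comm 2 (2 ^ k)) z<)

pad-injective : ∀ xs ys → pad xs ≡ pad ys → xs ≡ ys
pad-injective []       []       _ = refl
pad-injective (x ∷ xs) (y ∷ ys) eq with ∷-injective eq
... | x≡y , rest≡ = cong₂ _∷_ x≡y (pad-injective xs ys (∷-injectiveʳ rest≡))

length-pad : ∀ xs → length (pad xs) ≡ length xs * 2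
length-pad = length-concatMap _ (λ _ → refl)

pad-zero-within : ∀ xs {r} → r < length (pad xs) →
  ∃ λ t → t ≤ 1 × r + t < length (pad xs) × pad xs at suc (r + t) ≡ just 0
pad-zero-within (x ∷ xs) {zero}        _            = 1 , ≤-refl , s≤s (s≤s z≤n) , refl
pad-zero-within (x ∷ xs) {suc zero}    _            = 0 , z≤n , s≤s (s≤s z≤n) , refl
pad-zero-within (x ∷ xs) {suc (suc r)} (s≤s (s≤s r<)) with pad-zero-within xs r<
... | t , t≤1 , r+t< , at≡0 = t , t≤1 , s≤s (s≤s r+t<) , at≡0

frame-at : ∀ n (ys : List ℕ) {m} p → m ≡ n + p → (replicate n 1 ++ ys) at suc m ≡ ys at suc p
frame-at n ys p refl =
  subst (λ l → (replicate n 1 ++ ys) at suc (l + p) ≡ ys at suc p) (length-replicate n)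
        (at-++ʳ (replicate n 1) ys p)

frame-ones : ∀ n (ys : List ℕ) {t} → t < n → (replicate n 1 ++ ys) at suc t ≡ just 1
frame-ones n ys {t} t<n =
  trans (at-++ˡ (replicate n 1) ys (subst (suc t ≤_) (sym (length-replicate n {1})) t<n)) (at-replicate n 1 t<n)

length-frame : ∀ n (ys : List ℕ) → length (replicate n 1 ++ 0 ∷ ys) ≡ suc n + length ys
length-frame n ys = trans (length-++ (replicate n 1))
  (trans (cong (_+ suc (length ys)) (length-replicate n)) (+-suc n (length ys)))

frame-zero-within : ∀ {n} → 2 ≤ n → ∀ xs {o} → 1 ≤ o → o < suc n + length (pad xs) →
  ∃ λ t → t < n × o + t < suc n + length (pad xs) × (replicate n 1 ++ 0 ∷ pad xs) at suc (o + t) ≡ just 0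
frame-zero-within {n} 2≤n xs {o} 1≤o o< with o ≤? n
... | yes o≤n =
  n ∸ o , ∸-monoʳ-< 1≤o o≤n ,
  subst (_< suc n + length (pad xs)) (sym (m+[n∸m]≡n o≤n)) (m≤m+n (suc n) (length (pad xs))) ,
  frame-at n (0 ∷ pad xs) 0 (trans (m+[n∸m]≡n o≤n) (sym (+-identityʳ n)))
... | no o≰n with m≤n⇒∃[o]m+o≡n (≰⇒> o≰n)
...   | r , refl with pad-zero-within xs (+-cancelˡ-< (suc n) r _ o<)
...     | t , t≤1 , r+t< , at≡0 =
  t , <-≤-trans (s≤s t≤1) 2≤n ,
  subst (_< suc n + length (pad xs)) (sym (+-assoc (suc n) r t)) (+-monoʳ-< (suc n) r+t<) ,
  trans (frame-at n (0 ∷ pad xs) (suc (r + t)) (shift n r t)) at≡0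
  where
  shift : ∀ n r t → suc n + r + t ≡ n + suc (r + t)
  shift = solve-∀

block : ℕ → ℕ → List ℕ
block k a = blockB k ++ codeC k a

block-frame : ∀ k a → block k a ≡ replicate (2 * k ∸ 1) 1 ++ 0 ∷ codeC k a
block-frame k a = ++-assoc (replicate (2 * k ∸ 1) 1) (0 ∷ []) (codeC k a)

length-block-frame : ∀ {k} → 1 ≤ k → ∀ a → suc (2 * k ∸ 1) + length (codeC k a) ≡ 4 * k
length-block-frame {k} 1≤k a = begin
  suc (2 * k ∸ 1) + length (codeC k a)
    ≡⟨ cong₂ _+_ (m+[n∸m]≡n (≤-trans 1≤k (m≤m+n k _))) (length-pad (bin k a)) ⟩
  2 * k + length (bin k a) * 2          ≡⟨ cong (λ l → 2 * k + l * 2) (length-bin k a) ⟩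
  2 * k + k * 2                         ≡⟨ 2k+2k k ⟩
  4 * k                                 ∎
  where
  open ≡-Reasoning
  2k+2k : ∀ k → 2 * k + k * 2 ≡ 4 * k
  2k+2k = solve-∀

length-block : ∀ {k} → 1 ≤ k → ∀ a → length (block k a) ≡ 4 * k
length-block {k} 1≤k a = trans (cong length (block-frame k a))
  (trans (length-frame (2 * k ∸ 1) (codeC k a)) (length-block-frame 1≤k a))

block-injective : ∀ k {a b} → a < 2 ^ k → b < 2 ^ k → block k a ≡ block k b → a ≡ b
block-injective k a< b< eq = bin-injective k a< b< (pad-injective _ _ (++-cancelˡ (blockB k) _ _ eq))

block-ones : ∀ k a {t} → t < 2 * k ∸ 1 → block k a at suc t ≡ just 1
block-ones k a {t} t<n = trans (cong (_at suc t) (block-frame k a)) (frame-ones (2 * k ∸ 1) _ t<n)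

block-zero-within : ∀ {k} → 2 ≤ k → ∀ a {o} → 1 ≤ o → o < 4 * k →
  ∃ λ t → t < 2 * k ∸ 1 × o + t < 4 * k × block k a at suc (o + t) ≡ just 0
block-zero-within {k} 2≤k a {o} 1≤o o<4k =
  let t , t<n , o+t< , at≡0 = frame-zero-within 2≤2k∸1 (bin k a) 1≤o (subst (o <_) (sym length≡) o<4k)
  in  t , t<n , subst (o + t <_) length≡ o+t< , trans (cong (_at suc (o + t)) (block-frame k a)) at≡0
  where
  2≤2k∸1 : 2 ≤ 2 * k ∸ 1
  2≤2k∸1 = ≤-trans (s≤s (s≤s z≤n)) (∸-monoˡ-≤ 1 (*-monoʳ-≤ 2 2≤k))
  length≡ : suc (2 * k ∸ 1) + length (codeC k a) ≡ 4 * k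
  length≡ = length-block-frame (≤-trans (s≤s z≤n) 2≤k) a

block-crossBifixFree : ∀ {k} → 2 ≤ k → CrossBifixFree (block k) (4 * k)
block-crossBifixFree {k} 2≤k a b o 1≤o o<4k with block-zero-within 2≤k a 1≤o o<4k
... | t , t<n , o+t<4k , at≡0 =
  t , o+t<4k , λ eq → 0≢1+n (just-injective (trans (sym at≡0) (trans eq (block-ones k b t<n))))

divℕ≡/ : ∀ m d .{{_ : NonZero d}} → divℕ m d ≡ m / d
divℕ≡/ m (suc d) = refl

mainTheorem15 : (σ : ℕ) → 3 ≤ σ → (T : List ℕ) → All (λ a → a < σ) T →
    (i : ℕ) → 1 ≤ i → i ≤ length T →
    (Σ ℕ λ ℓ′ → IsLPF (encode σ T) ((i ∸ 1) * (4 * kOf σ) + 1) ℓ′ ×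
                 IsLPF T i (divℕ ℓ′ (4 * kOf σ))) ×
    (Σ ℕ λ ℓ′ → IsLPnF (encode σ T) ((i ∸ 1) * (4 * kOf σ) + 1) ℓ′ ×
                 IsLPnF T i (divℕ ℓ′ (4 * kOf σ)))
mainTheorem15 σ 3≤σ T T<σ (suc i) _ i<n
  with lpf-exists _≟_ (encode σ T) (i * (4 * kOf σ) + 1) | lpnf-exists _≟_ (encode σ T) (i * (4 * kOf σ) + 1)
... | ℓ , isLPF | ℓ′ , isLPnF =
    (ℓ  , isLPF  , subst (IsLPF T (suc i))  (sym (divℕ≡/ ℓ δ))  (IsLPF-concatMap⁻ inj cbf T<2^k i<n isLPF))
  , (ℓ′ , isLPnF , subst (IsLPnF T (suc i)) (sym (divℕ≡/ ℓ′ δ)) (IsLPnF-concatMap⁻ inj cbf T<2^k i<n isLPnF))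
  where
  k δ : ℕ
  k = kOf σ
  δ = 4 * k
  2≤k : 2 ≤ k
  2≤k = ⌈log₂⌉-mono-≤ 3≤σ
  instance
    δ≢0 : NonZero δ
    δ≢0 = >-nonZero (≤-trans (s≤s z≤n) (≤-trans 2≤k (m≤n*m k 4)))
  open BlockCode (block k) δ (length-block (≤-trans (s≤s z≤n) 2≤k))
  inj : ∀ {a b} → a < 2 ^ k → b < 2 ^ k → block k a ≡ block k b → a ≡ b
  inj = block-injective k
  cbf : CrossBifixFree (block k) δ
  cbf = block-crossBifixFree 2≤k
  T<2^k : All (_< 2 ^ k) T
  T<2^k = All.map (λ a<σ → <-≤-trans a<σ (n≤2^⌈log₂n⌉ σ)) T<σ
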